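{- For every integer $n\ge 2$ and every integer $k$, $$s_k(n+1)=s_{k-1}(n)+2s_k(n)-s_{k}(n-1).$$
   Context: A honeycomb strip of length $n$ consists of $n$ hexagons labelled $1,\dots,n$ arranged in two rows, in which hexagon $i$ is adjacent (shares an edge) exactly with hexagons $i\pm1$ and $i\pm 2$ (when these exist); equivalently its inner dual is the graph $P_n^2$ on vertices $1,\dots,n$ with $i\sim j$ iff $1\le |i-j|\le 2$. A division into $k$ pieces is a partition of the hexagons into $k$ blocks, each block connected (i.e., inducing a connected subgraph of $P_n^2$). Let $s_k(n)$ be the number of divisions of the honeycomb strip of length $n$ into exactly $k$ pieces such that the last two hexagons $n-1$ and $n$ lie in different pieces (with $s_k(1)=0$, and $s_k(n)=0$ for $k\le 0$). -}

module Defs where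

open import Data.Nat using (ℕ; zero; suc; _≤_; _<_; ∣_-_∣)
open import Data.Integer as ℤ using (ℤ; +_)
open import Data.Fin using (Fin; toℕ)
open import Data.Vec using (Vec; []; _∷_; lookup)
open import Data.List using (List; length)
open import Data.List.Membership.Propositional using (_∈_)
open import Data.List.Relation.Unary.Unique.Propositional using (Unique)
open import Data.Product using (Σ; _×_; ∃-syntax)
open import Data.Empty using (⊥)
open import Relation.Binary.PropositionalEquality using (_≡_; _≢_)
open import Function.Bundles using (_⇔_)

-- Hexagons are Fin n (hexagon i+1 of the paper is  i : Fin n).
-- Adjacency in the inner dual P_n^2 :  1 ≤ |i - j| ≤ 2.
Adj : {n : ℕ} → Fin n → Fin n → Set
Adj i j = (1 ≤ ∣ toℕ i - toℕ j ∣) × (∣ toℕ i - toℕ j ∣ ≤ 2)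

-- A division is encoded by a block-labelling  f : Vec ℕ n  (hexagon i lies in
-- block  lookup f i ).
data Walk {n : ℕ} (f : Vec ℕ n) : Fin n → Fin n → Set where
  here : ∀ {i} → Walk f i i
  step : ∀ {i m j} → Adj i m → lookup f m ≡ lookup f i → Walk f m j → Walk f i j

-- Canonical labelling of a set partition into exactly k blocks: the blocks are
-- numbered 0,…,k-1 in order of their smallest element (restricted growth
-- function), so each partition has exactly one labelling.
IsPartitionLabelling : {n : ℕ} → ℤ → Vec ℕ n → Set
IsPartitionLabelling {n} k f =
    (∀ (i : Fin n) → + lookup f i ℤ.< k)
  × (∀ (c : ℕ) → + c ℤ.< k → ∃[ i ] lookup f i ≡ c)
  × (∀ (i : Fin n) (c : ℕ) → c < lookup f i →
       ∃[ j ] (toℕ j < toℕ i × lookup f j ≡ c))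

BlocksConnected : {n : ℕ} → Vec ℕ n → Set
BlocksConnected {n} f = ∀ (i j : Fin n) → lookup f i ≡ lookup f j → Walk f i j

LastTwoDiffer : {n : ℕ} → Vec ℕ n → Set
LastTwoDiffer [] = ⊥
LastTwoDiffer (x ∷ []) = ⊥
LastTwoDiffer (x ∷ y ∷ []) = x ≢ y
LastTwoDiffer (x ∷ y ∷ z ∷ f) = LastTwoDiffer (y ∷ z ∷ f)

SDivision : (n : ℕ) → ℤ → Vec ℕ n → Set
SDivision n k f = IsPartitionLabelling k f × BlocksConnected f × LastTwoDiffer f

IsCount : {n : ℕ} → (Vec ℕ n → Set) → ℕ → Set
IsCount {n} P c = Σ (List (Vec ℕ n)) λ xs →
  Unique xs × (∀ f → (f ∈ xs) ⇔ P f) × length xs ≡ c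

S : ℕ → ℤ → ℕ → Set
S n k c = IsCount (SDivision n k) c

-- Let v_k(n) be the number of all divisions of the strip of length n into k pieces. In a
-- division counted by s_k(n+1) the last hexagon either forms a piece of its own, and
-- deleting it leaves an arbitrary division of length n into k-1 pieces, or it shares a
-- piece with an earlier hexagon. A piece of P_n^2 is connected exactly when consecutive
-- hexagons of it are at most two apart; since hexagon n lies in another piece, the last
-- hexagon must then join the piece of hexagon n-1, and deleting it leaves a division
-- counted by s_k(n). Hence s_k(n+1) = v_{k-1}(n) + s_k(n). Sorting the divisions counted
-- by v_{k-1}(n) by whether their last two hexagons share a piece gives
-- v_{k-1}(n) = s_{k-1}(n) + v_{k-1}(n-1), and eliminating v yields the recurrence.
module Submission where

open import Defs

module Counting where

  open import Data.Nat using (ℕ; _+_)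
  open import Data.List using (List; []; _∷_; length; map; filter; _++_)
  open import Data.List.Properties using (length-map; length-++)
  open import Data.List.Membership.Propositional using (_∈_)
  open import Data.List.Membership.Propositional.Properties
    using (∈-map⁺; ∈-map⁻; ∈-filter⁺; ∈-filter⁻; ++-∈⇔)
  open import Data.List.Membership.Propositional.Properties.WithK using (unique∧set⇒bag)
  open import Data.List.Relation.Unary.Any using (here; there)
  import Data.List.Relation.Unary.All as All
  import Data.List.Relation.Unary.All.Properties as Allₚ
  open import Data.List.Relation.Unary.AllPairs using ([]; _∷_)
  open import Data.List.Relation.Unary.Unique.Propositional using (Unique)
  import Data.List.Relation.Unary.Unique.Propositional.Properties as Uniqueₚ
  open import Data.List.Relation.Binary.BagAndSetEquality using (∼bag⇒↭)
  open import Data.List.Relation.Binary.Permutation.Propositional.Properties using (↭-length)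
  open import Data.Product using (Σ; _×_; _,_; proj₁; ∃-syntax; ∃₂)
  open import Data.Sum as Sum using (_⊎_)
  open import Data.Sum.Function.Propositional using (_⊎-cong_)
  open import Function.Bundles using (_⇔_; mk⇔; Equivalence)
  import Function.Properties.Equivalence as ⇔
  open import Level using (0ℓ)
  open import Relation.Nullary using (¬_; contradiction)
  open import Relation.Nullary.Decidable using (toSum)
  open import Relation.Unary using (Pred; Decidable; _∩_; ∁)
  open import Relation.Unary.Properties using (∁?)
  open import Relation.Binary.PropositionalEquality using (_≡_; refl; sym; trans; subst)

  open Equivalence using (to; from)

  Count : {A : Set} → Pred A 0ℓ → ℕ → Set
  Count {A} P c = Σ (List A) λ xs → Unique xs × (∀ x → x ∈ xs ⇔ P x) × length xs ≡ c

  module _ {A : Set} where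
    private
      variable
        P Q R : Pred A 0ℓ
        a b : ℕ

    count-unique : Count P a → Count P b → a ≡ b
    count-unique (xs , xs! , xs⇔ , refl) (ys , ys! , ys⇔ , refl) =
      ↭-length (∼bag⇒↭ (unique∧set⇒bag xs! ys! λ {x} → ⇔.trans (xs⇔ x) (⇔.sym (ys⇔ x))))

    count-cong : (∀ x → P x ⇔ Q x) → Count P a → Count Q a
    count-cong P⇔Q (xs , xs! , xs⇔ , len) = xs , xs! , (λ x → ⇔.trans (xs⇔ x) (P⇔Q x)) , len

    count-empty : (∀ x → ¬ P x) → Count P a → a ≡ 0
    count-empty ¬P ([] , _ , _ , len)      = sym len
    count-empty ¬P (x ∷ _ , _ , xs⇔ , _) = contradiction (to (xs⇔ x) (here refl)) (¬P x)

    count-⊎ : (∀ x → P x → ¬ Q x) → (∀ x → R x ⇔ (P x ⊎ Q x)) →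
              Count P a → Count Q b → Count R (a + b)
    count-⊎ disjoint R⇔ (xs , xs! , xs⇔ , refl) (ys , ys! , ys⇔ , refl) =
      xs ++ ys ,
      Uniqueₚ.++⁺ xs! ys! (λ (x∈xs , x∈ys) → disjoint _ (to (xs⇔ _) x∈xs) (to (ys⇔ _) x∈ys)) ,
      (λ x → ⇔.trans ++-∈⇔ (⇔.trans (xs⇔ x ⊎-cong ys⇔ x) (⇔.sym (R⇔ x)))) ,
      length-++ xs

    count-∩ : Decidable Q → Count P a → ∃[ b ] Count (P ∩ Q) b
    count-∩ Q? (xs , xs! , xs⇔ , _) =
      length (filter Q? xs) , filter Q? xs , Uniqueₚ.filter⁺ Q? xs! ,
      (λ x → mk⇔ (λ x∈ → let (x∈xs , Qx) = ∈-filter⁻ Q? x∈ in to (xs⇔ x) x∈xs , Qx)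
                 (λ (Px , Qx) → ∈-filter⁺ Q? (from (xs⇔ x) Px) Qx)) ,
      refl

    count-split : Decidable Q → Count P a →
                  ∃₂ λ b c → Count (P ∩ Q) b × Count (P ∩ ∁ Q) c × b + c ≡ a
    count-split {Q = Q} {P = P} Q? count
      with b , countQ ← count-∩ Q? count | c , count¬Q ← count-∩ (∁? Q?) count =
      b , c , countQ , count¬Q ,
      count-unique (count-⊎ (λ _ (_ , Qx) (_ , ¬Qx) → ¬Qx Qx) P⇔ countQ count¬Q) count
      where
      P⇔ : ∀ x → P x ⇔ ((P ∩ Q) x ⊎ (P ∩ ∁ Q) x)
      P⇔ x = mk⇔ (λ Px → Sum.map (Px ,_) (Px ,_) (toSum (Q? x))) Sum.[ proj₁ , proj₁ ]′

  unique-map⁺ : {A B : Set} (h : A → B) {xs : List A} →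
                (∀ {x y} → x ∈ xs → y ∈ xs → h x ≡ h y → x ≡ y) → Unique xs → Unique (map h xs)
  unique-map⁺ h inj [] = []
  unique-map⁺ h inj (x∉xs ∷ xs!) =
    Allₚ.map⁺ (All.tabulate λ y∈xs hx≡hy →
                All.lookup x∉xs y∈xs (inj (here refl) (there y∈xs) hx≡hy))
    ∷ unique-map⁺ h (λ x∈ y∈ → inj (there x∈) (there y∈)) xs!

  count-image : {A B : Set} {P : Pred A 0ℓ} {Q : Pred B 0ℓ} {a : ℕ} (h : A → B) →
                (∀ {x y} → P x → P y → h x ≡ h y → x ≡ y) →
                (∀ y → Q y ⇔ (∃[ x ] P x × h x ≡ y)) → Count P a → Count Q a
  count-image h inj Q⇔ (xs , xs! , xs⇔ , len) =
    map h xs ,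
    unique-map⁺ h (λ x∈ y∈ → inj (to (xs⇔ _) x∈) (to (xs⇔ _) y∈)) xs! ,
    (λ y → mk⇔ (λ y∈ → let (x , x∈xs , y≡hx) = ∈-map⁻ h y∈ in
                        from (Q⇔ y) (x , to (xs⇔ x) x∈xs , sym y≡hx))
               (λ Qy → let (x , Px , hx≡y) = to (Q⇔ y) Qy in
                        subst (_∈ map h xs) hx≡y (∈-map⁺ h (from (xs⇔ x) Px)))) ,
    trans (length-map h xs) len

module HoneycombStrip where

  open import Data.Nat using (ℕ; zero; suc; _+_; _≤_; _<_; _≤?_; _<?_; _≟_; s≤s; s≤s⁻¹; ∣_-_∣)
  open import Data.Nat.Properties
  open import Data.Integer as ℤ using (+_)
  import Data.Integer.Properties as ℤ
  open import Data.Fin using (Fin; toℕ; zero; suc; inject₁; fromℕ)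
  open import Data.Fin.Properties
    using (toℕ-injective; toℕ-inject₁; toℕ-fromℕ; toℕ<n; inject₁ℕ<; ≤fromℕ; any?)
  open import Data.Vec using (Vec; []; _∷_; lookup; _∷ʳ_; init; last; initLast)
  open import Data.Vec.Properties using (init-∷ʳ; last-∷ʳ; ∷ʳ-injectiveˡ)
  open import Data.Product using (_×_; _,_; proj₁; proj₂; ∃-syntax; ∃₂)
  open import Data.Product.Function.NonDependent.Propositional using (_×-⇔_)
  open import Data.Sum as Sum using (_⊎_; inj₁; inj₂)
  open import Function.Base using (_∘_; id)
  open import Function.Bundles using (_⇔_; mk⇔; Equivalence)
  import Function.Properties.Equivalence as ⇔
  open import Function.Related.TypeIsomorphisms using (¬-cong-⇔)
  open import Level using (0ℓ)
  open import Relation.Nullary using (¬_; yes; no; contradiction)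
  open import Relation.Unary using (Pred; Decidable)
  open import Relation.Binary.Definitions using (tri<; tri≈; tri>)
  open import Relation.Binary.PropositionalEquality

  open Counting
  open Equivalence using (to; from)

  data Position {N : ℕ} : Fin (suc N) → Set where
    earlier : (i : Fin N) → Position (inject₁ i)
    final   : Position (fromℕ N)

  position : ∀ {N} (q : Fin (suc N)) → Position q
  position {zero}  zero    = final
  position {suc N} zero    = earlier zero
  position {suc N} (suc q) with position q
  ... | earlier i = earlier (suc i)
  ... | final     = final

  inject₁<fromℕ : ∀ {N} (i : Fin N) → toℕ (inject₁ i) < toℕ (fromℕ N)
  inject₁<fromℕ {N} i = subst (toℕ (inject₁ i) <_) (sym (toℕ-fromℕ N)) (inject₁ℕ< i)

  module _ {A : Set} where

    lookup-∷ʳ-inject₁ : ∀ {N} (f : Vec A N) x i → lookup (f ∷ʳ x) (inject₁ i) ≡ lookup f i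
    lookup-∷ʳ-inject₁ (y ∷ f) x zero    = refl
    lookup-∷ʳ-inject₁ (y ∷ f) x (suc i) = lookup-∷ʳ-inject₁ f x i

    lookup-∷ʳ-fromℕ : ∀ {N} (f : Vec A N) x → lookup (f ∷ʳ x) (fromℕ N) ≡ x
    lookup-∷ʳ-fromℕ []      x = refl
    lookup-∷ʳ-fromℕ (y ∷ f) x = lookup-∷ʳ-fromℕ f x

  ShortStep : ℕ → ℕ → Set
  ShortStep a b = a < b × b ≤ 2 + a

  shortStep-inject₁ : ∀ {N} {i m : Fin N} →
    ShortStep (toℕ (inject₁ i)) (toℕ (inject₁ m)) ⇔ ShortStep (toℕ i) (toℕ m)
  shortStep-inject₁ {i = i} {m} =
    mk⇔ (subst₂ ShortStep (toℕ-inject₁ i) (toℕ-inject₁ m))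
        (subst₂ ShortStep (sym (toℕ-inject₁ i)) (sym (toℕ-inject₁ m)))

  ∣m-n∣≤o⇒n≤o+m : ∀ m n {o} → ∣ m - n ∣ ≤ o → n ≤ o + m
  ∣m-n∣≤o⇒n≤o+m m n {o} ∣m-n∣≤o = begin
    n             ≤⟨ m≤∣m-n∣+n n m ⟩
    ∣ n - m ∣ + m ≡⟨ cong (_+ m) (∣-∣-comm n m) ⟩
    ∣ m - n ∣ + m ≤⟨ +-monoˡ-≤ m ∣m-n∣≤o ⟩
    o + m         ∎
    where open ≤-Reasoning

  module _ {N : ℕ} where

    Adj-sym : {i j : Fin N} → Adj i j → Adj j i
    Adj-sym {i} {j} = subst (λ d → 1 ≤ d × d ≤ 2) (∣-∣-comm (toℕ i) (toℕ j))

    Adj⇒≤2+ : {i j : Fin N} → Adj i j → toℕ j ≤ 2 + toℕ i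
    Adj⇒≤2+ {i} {j} (_ , d≤2) = ∣m-n∣≤o⇒n≤o+m (toℕ i) (toℕ j) d≤2

    shortStep⇒Adj : {i j : Fin N} → ShortStep (toℕ i) (toℕ j) → Adj i j
    shortStep⇒Adj {i} {j} (i<j , j≤2+i) rewrite m≤n⇒∣m-n∣≡n∸m (<⇒≤ i<j) =
      m<n⇒0<n∸m i<j , ≤-trans (∸-monoˡ-≤ (toℕ i) j≤2+i) (≤-reflexive (m+n∸n≡m 2 (toℕ i)))

  module _ {A : Set} {N : ℕ} where

    NextWithinTwo : Vec A N → Fin N → Set
    NextWithinTwo f i = ∃[ m ] (ShortStep (toℕ i) (toℕ m) × lookup f m ≡ lookup f i)

    ShortGaps : Vec A N → Set
    ShortGaps f = ∀ i j → toℕ i < toℕ j → lookup f i ≡ lookup f j → NextWithinTwo f i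

  module _ {N : ℕ} {f : Vec ℕ N} where

    walk-trans : ∀ {i m j} → Walk f i m → Walk f m j → Walk f i j
    walk-trans here                w = w
    walk-trans (step adj fm≡fi v) w = step adj fm≡fi (walk-trans v w)

    walk-sym : ∀ {i j} → Walk f i j → Walk f j i
    walk-sym here                       = here
    walk-sym (step {i} {m} adj fm≡fi w) =
      walk-trans (walk-sym w) (step (Adj-sym {i = i} {j = m} adj) (sym fm≡fi) here)

    walk-crosses : ∀ {a j} (i : Fin N) → Walk f a j → toℕ a ≤ toℕ i → toℕ i < toℕ j →
      ∃[ m ] (ShortStep (toℕ i) (toℕ m) × lookup f m ≡ lookup f a)
    walk-crosses i here a≤i i<a = contradiction (≤-<-trans a≤i i<a) (<-irrefl refl)
    walk-crosses {a} i (step {m = m} adj fm≡fa w) a≤i i<j with toℕ m ≤? toℕ i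
    ... | yes m≤i = let (m′ , i⋖m′ , fm′≡fm) = walk-crosses i w m≤i i<j
                    in m′ , i⋖m′ , trans fm′≡fm fm≡fa
    ... | no m≰i  = m , (≰⇒> m≰i , ≤-trans (Adj⇒≤2+ adj) (+-monoʳ-≤ 2 a≤i)) , fm≡fa

    forward-walk : ShortGaps f → ∀ d {i j} → toℕ i ≤ toℕ j → toℕ j ≤ d + toℕ i →
                   lookup f i ≡ lookup f j → Walk f i j
    forward-walk gaps zero i≤j j≤i _ with refl ← toℕ-injective (≤-antisym i≤j j≤i) = here
    forward-walk gaps (suc d) {i} {j} i≤j j≤1+d+i fi≡fj with m≤n⇒m<n∨m≡n i≤j
    ... | inj₂ i≡j with refl ← toℕ-injective i≡j = here
    ... | inj₁ i<j with gaps i j i<j fi≡fj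
    ... | m , (i<m , m≤2+i) , fm≡fi with toℕ m ≤? toℕ j
    ... | no m≰j  = step (shortStep⇒Adj (i<j , ≤-trans (<⇒≤ (≰⇒> m≰j)) m≤2+i)) (sym fi≡fj) here
    ... | yes m≤j = step (shortStep⇒Adj (i<m , m≤2+i)) fm≡fi
                      (forward-walk gaps d m≤j j≤d+m (trans fm≡fi fi≡fj))
      where
      j≤d+m : toℕ j ≤ d + toℕ m
      j≤d+m = ≤-trans j≤1+d+i (≤-trans (≤-reflexive (sym (+-suc d (toℕ i)))) (+-monoʳ-≤ d i<m))

    connected⇔shortGaps : BlocksConnected f ⇔ ShortGaps f
    connected⇔shortGaps = mk⇔
      (λ conn i j i<j fi≡fj → walk-crosses i (conn i j fi≡fj) ≤-refl i<j)
      (λ gaps i j fi≡fj →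
         Sum.[ (λ i≤j → forward-walk gaps (toℕ j) i≤j (m≤m+n _ _) fi≡fj)
             , (λ j≤i → walk-sym (forward-walk gaps (toℕ i) j≤i (m≤m+n _ _) (sym fi≡fj)))
             ]′ (≤-total (toℕ i) (toℕ j)))

  module _ {A : Set} {N : ℕ} where

    Occurs : Vec A N → A → Set
    Occurs f x = ∃[ i ] lookup f i ≡ x

    OccursBefore : Vec A N → Fin N → A → Set
    OccursBefore f i x = ∃[ j ] (toℕ j < toℕ i × lookup f j ≡ x)

    InLastTwo : Vec A N → A → Set
    InLastTwo f x = ∃[ p ] (lookup f p ≡ x × N ≤ 2 + toℕ p)

  module _ {A : Set} {N : ℕ} (f : Vec A N) (x : A) where
    private
      lookup-old : ∀ i → lookup (f ∷ʳ x) (inject₁ i) ≡ lookup f i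
      lookup-old = lookup-∷ʳ-inject₁ f x

      lookup-new : lookup (f ∷ʳ x) (fromℕ N) ≡ x
      lookup-new = lookup-∷ʳ-fromℕ f x

    occurs-∷ʳ⁺ : ∀ {c} → Occurs f c → Occurs (f ∷ʳ x) c
    occurs-∷ʳ⁺ (i , fi≡c) = inject₁ i , trans (lookup-old i) fi≡c

    occurs-∷ʳ⁻ : ∀ {c} → Occurs (f ∷ʳ x) c → Occurs f c ⊎ x ≡ c
    occurs-∷ʳ⁻ (q , Fq≡c) with position q
    ... | earlier i = inj₁ (i , trans (sym (lookup-old i)) Fq≡c)
    ... | final     = inj₂ (trans (sym lookup-new) Fq≡c)

    occursBefore-∷ʳ⁺ : ∀ {i c} → OccursBefore f i c → OccursBefore (f ∷ʳ x) (inject₁ i) c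
    occursBefore-∷ʳ⁺ {i} (j , j<i , fj≡c) =
      inject₁ j , subst₂ _<_ (sym (toℕ-inject₁ j)) (sym (toℕ-inject₁ i)) j<i ,
      trans (lookup-old j) fj≡c

    occursBefore-∷ʳ⁻ : ∀ {i c} → OccursBefore (f ∷ʳ x) (inject₁ i) c → OccursBefore f i c
    occursBefore-∷ʳ⁻ {i} (q , q<i , Fq≡c) with position q
    ... | earlier j = j , subst₂ _<_ (toℕ-inject₁ j) (toℕ-inject₁ i) q<i ,
                      trans (sym (lookup-old j)) Fq≡c
    ... | final     = contradiction (inject₁<fromℕ i) (<-asym q<i)

    occursBefore-final : ∀ {c} → OccursBefore (f ∷ʳ x) (fromℕ N) c ⇔ Occurs f c
    occursBefore-final = mk⇔ before⇒occurs occurs⇒before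
      where
      before⇒occurs : ∀ {c} → OccursBefore (f ∷ʳ x) (fromℕ N) c → Occurs f c
      before⇒occurs (q , q<N , Fq≡c) with position q
      ... | earlier j = j , trans (sym (lookup-old j)) Fq≡c
      ... | final     = contradiction q<N (<-irrefl refl)
      occurs⇒before : ∀ {c} → Occurs f c → OccursBefore (f ∷ʳ x) (fromℕ N) c
      occurs⇒before (i , fi≡c) = inject₁ i , inject₁<fromℕ i , trans (lookup-old i) fi≡c

    nextWithinTwo-∷ʳ⁺ : ∀ {i} → NextWithinTwo f i → NextWithinTwo (f ∷ʳ x) (inject₁ i)
    nextWithinTwo-∷ʳ⁺ {i} (m , i⋖m , fm≡fi) =
      inject₁ m , from shortStep-inject₁ i⋖m ,
      trans (lookup-old m) (trans fm≡fi (sym (lookup-old i)))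

    nextWithinTwo-∷ʳ⁻ : ∀ {i} → NextWithinTwo (f ∷ʳ x) (inject₁ i) →
                        NextWithinTwo f i ⊎ (N ≤ 2 + toℕ i × lookup f i ≡ x)
    nextWithinTwo-∷ʳ⁻ {i} (q , i⋖q , Fq≡Fi) with position q
    ... | earlier m = inj₁ (m , to shortStep-inject₁ i⋖q ,
                            trans (sym (lookup-old m)) (trans Fq≡Fi (lookup-old i)))
    ... | final     = inj₂ (subst₂ (λ a b → a ≤ 2 + b) (toℕ-fromℕ N) (toℕ-inject₁ i) (proj₂ i⋖q) ,
                            trans (sym (lookup-old i)) (trans (sym Fq≡Fi) lookup-new))

    shortGaps-∷ʳ⁻ : ShortGaps (f ∷ʳ x) → ShortGaps f
    shortGaps-∷ʳ⁻ gaps i j i<j fi≡fj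
      with nextWithinTwo-∷ʳ⁻ (gaps (inject₁ i) (inject₁ j)
                                    (subst₂ _<_ (sym (toℕ-inject₁ i)) (sym (toℕ-inject₁ j)) i<j)
                                    (trans (lookup-old i) (trans fi≡fj (sym (lookup-old j)))))
    ... | inj₁ next        = next
    ... | inj₂ (N≤2+i , _) = j , (i<j , <⇒≤ (<-≤-trans (toℕ<n j) N≤2+i)) , sym fi≡fj

    shortGaps-∷ʳ⇒inLastTwo : ShortGaps (f ∷ʳ x) → Occurs f x → InLastTwo f x
    shortGaps-∷ʳ⇒inLastTwo gaps (i , fi≡x) = go N i (m≤m+n N (toℕ i)) fi≡x
      where
      go : ∀ d i → N ≤ d + toℕ i → lookup f i ≡ x → InLastTwo f x
      go zero    i N≤i _ = contradiction (toℕ<n i) (≤⇒≯ N≤i)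
      go (suc d) i N≤1+d+i fi≡x
        with nextWithinTwo-∷ʳ⁻ (gaps (inject₁ i) (fromℕ N) (inject₁<fromℕ i)
                                      (trans (lookup-old i) (trans fi≡x (sym lookup-new))))
      ... | inj₂ (N≤2+i , _)             = i , fi≡x , N≤2+i
      ... | inj₁ (m , (i<m , _) , fm≡fi) =
        go d m (≤-trans N≤1+d+i (≤-trans (≤-reflexive (sym (+-suc d (toℕ i)))) (+-monoʳ-≤ d i<m)))
               (trans fm≡fi fi≡x)

    shortGaps-∷ʳ⁺ : ShortGaps f → ¬ Occurs f x ⊎ InLastTwo f x → ShortGaps (f ∷ʳ x)
    shortGaps-∷ʳ⁺ gaps new-or-near q r q<r Fq≡Fr with position q | position r
    ... | final     | _         = contradiction (≤fromℕ r) (<⇒≱ q<r)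
    ... | earlier i | earlier j =
      nextWithinTwo-∷ʳ⁺ (gaps i j (subst₂ _<_ (toℕ-inject₁ i) (toℕ-inject₁ j) q<r)
                                  (trans (sym (lookup-old i)) (trans Fq≡Fr (lookup-old j))))
    ... | earlier i | final     =
      toFinal new-or-near i (trans (sym (lookup-old i)) (trans Fq≡Fr lookup-new))
      where
      toFinal : ¬ Occurs f x ⊎ InLastTwo f x →
                ∀ i → lookup f i ≡ x → NextWithinTwo (f ∷ʳ x) (inject₁ i)
      toFinal (inj₁ x∉f) i fi≡x = contradiction (i , fi≡x) x∉f
      toFinal (inj₂ (p , fp≡x , N≤2+p)) i fi≡x with toℕ i <? toℕ p
      ... | yes i<p = nextWithinTwo-∷ʳ⁺ (gaps i p i<p (trans fi≡x (sym fp≡x)))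
      ... | no i≮p  =
        fromℕ N ,
        (inject₁<fromℕ i , subst₂ (λ a b → a ≤ 2 + b) (sym (toℕ-fromℕ N)) (sym (toℕ-inject₁ i))
                                  (≤-trans N≤2+p (+-monoʳ-≤ 2 (≮⇒≥ i≮p)))) ,
        trans lookup-new (trans (sym fi≡x) (sym (lookup-old i)))

  Labelling : {N : ℕ} → ℕ → Vec ℕ N → Set
  Labelling {N} K f = (∀ (i : Fin N) → lookup f i < K)
                    × (∀ c → c < K → Occurs f c)
                    × (∀ (i : Fin N) c → c < lookup f i → OccursBefore f i c)

  labelling⇔ : ∀ {N K} {f : Vec ℕ N} → IsPartitionLabelling (+ K) f ⇔ Labelling K f
  labelling⇔ = mk⇔
    (λ (bound , onto , growth) →
       (λ i → ℤ.drop‿+<+ (bound i)) , (λ c c<K → onto c (ℤ.+<+ c<K)) , growth)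
    (λ (bound , onto , growth) →
       (λ i → ℤ.+<+ (bound i)) , (λ c c<K → onto c (ℤ.drop‿+<+ c<K)) , growth)

  labelling⇒¬occurs : ∀ {N K} (f : Vec ℕ N) → Labelling K f → ¬ Occurs f K
  labelling⇒¬occurs f (bound , _) (i , fi≡K) = <-irrefl fi≡K (bound i)

  module _ {N : ℕ} (f : Vec ℕ N) (x : ℕ) where
    private
      lookup-old : ∀ i → lookup (f ∷ʳ x) (inject₁ i) ≡ lookup f i
      lookup-old = lookup-∷ʳ-inject₁ f x

      lookup-new : lookup (f ∷ʳ x) (fromℕ N) ≡ x
      lookup-new = lookup-∷ʳ-fromℕ f x

      growth-∷ʳ⁻ : ∀ {K} → Labelling K (f ∷ʳ x) → ∀ i c → c < lookup f i → OccursBefore f i c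
      growth-∷ʳ⁻ (_ , _ , growth) i c c<fi =
        occursBefore-∷ʳ⁻ f x (growth (inject₁ i) c (subst (c <_) (sym (lookup-old i)) c<fi))

      growth-∷ʳ⁺ : (∀ i c → c < lookup f i → OccursBefore f i c) → (∀ c → c < x → Occurs f c) →
                   ∀ q c → c < lookup (f ∷ʳ x) q → OccursBefore (f ∷ʳ x) q c
      growth-∷ʳ⁺ growth below-x q c c<Fq with position q
      ... | earlier i = occursBefore-∷ʳ⁺ f x (growth i c (subst (c <_) (lookup-old i) c<Fq))
      ... | final     = from (occursBefore-final f x) (below-x c (subst (c <_) lookup-new c<Fq))

    labelling-∷ʳ⁻-old : ∀ {K} → Labelling K (f ∷ʳ x) → Occurs f x → Labelling K f
    labelling-∷ʳ⁻-old {K} L@(bound , onto , _) x∈f =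
      (λ i → subst (_< K) (lookup-old i) (bound (inject₁ i))) ,
      (λ c c<K → Sum.[ id , (λ x≡c → subst (Occurs f) x≡c x∈f) ]′
                   (occurs-∷ʳ⁻ f x (onto c c<K))) ,
      growth-∷ʳ⁻ L

    labelling-∷ʳ⁻-new : ∀ {K} → Labelling K (f ∷ʳ x) → ¬ Occurs f x → K ≡ suc x × Labelling x f
    labelling-∷ʳ⁻-new {K} L@(bound , onto , growth) x∉f =
      ≤-antisym K≤1+x x<K , bound′ , onto′ , growth-∷ʳ⁻ L
      where
      bound′ : ∀ i → lookup f i < x
      bound′ i with <-cmp (lookup f i) x
      ... | tri< fi<x _ _ = fi<x
      ... | tri≈ _ fi≡x _ = contradiction (i , fi≡x) x∉f
      ... | tri> _ _ x<fi = let (j , _ , fj≡x) = growth-∷ʳ⁻ L i x x<fi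
                            in contradiction (j , fj≡x) x∉f
      x<K : x < K
      x<K = subst (_< K) lookup-new (bound (fromℕ N))
      K≤1+x : K ≤ suc x
      K≤1+x = ≮⇒≥ λ 1+x<K → Sum.[ (λ (i , fi≡1+x) → <-asym (bound′ i) (≤-reflexive (sym fi≡1+x)))
                                , (λ x≡1+x → <-irrefl x≡1+x (n<1+n x))
                                ]′ (occurs-∷ʳ⁻ f x (onto (suc x) 1+x<K))
      onto′ : ∀ c → c < x → Occurs f c
      onto′ c c<x =
        to (occursBefore-final f x) (growth (fromℕ N) c (subst (c <_) (sym lookup-new) c<x))

    labelling-∷ʳ⁺-old : ∀ {K} → Labelling K f → Occurs f x → Labelling K (f ∷ʳ x)
    labelling-∷ʳ⁺-old {K} (bound , onto , growth) (i₀ , fi₀≡x) =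
      bound′ , (λ c c<K → occurs-∷ʳ⁺ f x (onto c c<K)) ,
      growth-∷ʳ⁺ growth (λ c c<x → onto c (<-trans c<x (subst (_< K) fi₀≡x (bound i₀))))
      where
      bound′ : ∀ q → lookup (f ∷ʳ x) q < K
      bound′ q with position q
      ... | earlier i = subst (_< K) (sym (lookup-old i)) (bound i)
      ... | final     = subst (_< K) (trans fi₀≡x (sym lookup-new)) (bound i₀)

    labelling-∷ʳ⁺-new : Labelling x f → Labelling (suc x) (f ∷ʳ x)
    labelling-∷ʳ⁺-new (bound , onto , growth) = bound′ , onto′ , growth-∷ʳ⁺ growth onto
      where
      bound′ : ∀ q → lookup (f ∷ʳ x) q < suc x
      bound′ q with position q
      ... | earlier i = subst (_< suc x) (sym (lookup-old i)) (m<n⇒m<1+n (bound i))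
      ... | final     = subst (_< suc x) (sym lookup-new) (n<1+n x)
      onto′ : ∀ c → c < suc x → Occurs (f ∷ʳ x) c
      onto′ c c<1+x with m≤n⇒m<n∨m≡n (s≤s⁻¹ c<1+x)
      ... | inj₁ c<x  = occurs-∷ʳ⁺ f x (onto c c<x)
      ... | inj₂ refl = fromℕ N , lookup-new

  lastTwoDiffer-∷ʳ : ∀ {M} (f : Vec ℕ (suc M)) x → LastTwoDiffer (f ∷ʳ x) ⇔ (lookup f (fromℕ M) ≢ x)
  lastTwoDiffer-∷ʳ (y ∷ [])         x = ⇔.refl
  lastTwoDiffer-∷ʳ (y ∷ z ∷ [])     x = ⇔.refl
  lastTwoDiffer-∷ʳ (y ∷ z ∷ w ∷ f) x = lastTwoDiffer-∷ʳ (z ∷ w ∷ f) x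

  Penultimate : ∀ {A : Set} {M} → Vec A (suc M) → A → Set
  Penultimate {M = M} f x = InLastTwo f x × lookup f (fromℕ M) ≢ x

  module _ {A : Set} where

    penultimate-∷⁻ : ∀ {M} {y z w : A} {f : Vec A M} {x} →
                     Penultimate (y ∷ z ∷ w ∷ f) x → Penultimate (z ∷ w ∷ f) x
    penultimate-∷⁻ ((zero  , _    , s≤s (s≤s ())) , _)
    penultimate-∷⁻ ((suc p , fp≡x , 3+M≤3+p) , fM≢x) = (p , fp≡x , s≤s⁻¹ 3+M≤3+p) , fM≢x

    penultimate-unique : ∀ {M} (f : Vec A (suc M)) {x y} → Penultimate f x → Penultimate f y → x ≡ y
    penultimate-unique (a ∷ [])     ((zero , a≡x , _) , a≢x) _ = contradiction a≡x a≢x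
    penultimate-unique (a ∷ b ∷ []) ((suc zero , b≡x , _) , b≢x) _ = contradiction b≡x b≢x
    penultimate-unique (a ∷ b ∷ []) _ ((suc zero , b≡y , _) , b≢y) = contradiction b≡y b≢y
    penultimate-unique (a ∷ b ∷ []) ((zero , a≡x , _) , _) ((zero , a≡y , _) , _) =
      trans (sym a≡x) a≡y
    penultimate-unique (a ∷ b ∷ c ∷ f) pen-x pen-y =
      penultimate-unique (b ∷ c ∷ f) (penultimate-∷⁻ pen-x) (penultimate-∷⁻ pen-y)

  lastTwoDiffer⇒penultimate : ∀ {M} (f : Vec ℕ (suc M)) → LastTwoDiffer f → ∃[ x ] Penultimate f x
  lastTwoDiffer⇒penultimate (y ∷ z ∷ [])     y≢z = y , (zero , refl , ≤-refl) , y≢z ∘ sym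
  lastTwoDiffer⇒penultimate (y ∷ z ∷ w ∷ f) ltd
    with x , (p , fp≡x , 2+M≤2+p) , fM≢x ← lastTwoDiffer⇒penultimate (z ∷ w ∷ f) ltd =
    x , (suc p , fp≡x , s≤s 2+M≤2+p) , fM≢x

  penultimate⇒lastTwoDiffer : ∀ {M} (f : Vec ℕ (suc M)) {x} → Penultimate f x → LastTwoDiffer f
  penultimate⇒lastTwoDiffer (y ∷ [])         ((zero , y≡x , _) , y≢x)     = y≢x y≡x
  penultimate⇒lastTwoDiffer (y ∷ z ∷ [])     ((zero , y≡x , _) , z≢x) y≡z =
    z≢x (trans (sym y≡z) y≡x)
  penultimate⇒lastTwoDiffer (y ∷ z ∷ [])     ((suc zero , z≡x , _) , z≢x) = contradiction z≡x z≢x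
  penultimate⇒lastTwoDiffer (y ∷ z ∷ w ∷ f) pen =
    penultimate⇒lastTwoDiffer (z ∷ w ∷ f) (penultimate-∷⁻ pen)

  count-init : ∀ {A : Set} {N a} {P : Pred (Vec A (suc N)) 0ℓ} {Q : Pred (Vec A N) 0ℓ}
               (R : Vec A N → A → Set) → (∀ {f x y} → R f x → R f y → x ≡ y) →
               (∀ {f} → Q f → ∃[ x ] R f x) → (∀ f x → P (f ∷ʳ x) ⇔ (Q f × R f x)) →
               Count P a → Count Q a
  count-init {P = P} {Q} R R-unique R-total P⇔ = count-image init init-injective Q⇔
    where
    init-injective : ∀ {g₁ g₂} → P g₁ → P g₂ → init g₁ ≡ init g₂ → g₁ ≡ g₂
    init-injective {g₁} {g₂} Pg₁ Pg₂ init≡ with initLast g₁ | initLast g₂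
    ... | f₁ , x₁ , refl | f₂ , x₂ , refl with refl ← init≡ =
      cong (f₁ ∷ʳ_) (R-unique (proj₂ (to (P⇔ f₁ x₁) Pg₁)) (proj₂ (to (P⇔ f₁ x₂) Pg₂)))

    init-image : ∀ {f} g → P g → init g ≡ f → Q f
    init-image g Pg init≡ with initLast g
    ... | f , x , refl = subst Q init≡ (proj₁ (to (P⇔ f x) Pg))

    Q⇔ : ∀ f → Q f ⇔ (∃[ g ] P g × init g ≡ f)
    Q⇔ f = mk⇔ (λ Qf → let (x , Rfx) = R-total Qf
                        in f ∷ʳ x , from (P⇔ f x) (Qf , Rfx) , init-∷ʳ x f)
               (λ (g , Pg , init≡) → init-image g Pg init≡)

  Division : {N : ℕ} → ℕ → Vec ℕ N → Set
  Division K f = Labelling K f × ShortGaps f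

  SDivisionℕ : {N : ℕ} → ℕ → Vec ℕ N → Set
  SDivisionℕ K f = Division K f × LastTwoDiffer f

  SDivision⇔SDivisionℕ : ∀ {N K} (f : Vec ℕ N) → SDivision N (+ K) f ⇔ SDivisionℕ K f
  SDivision⇔SDivisionℕ f = mk⇔
    (λ (lab , conn , ltd) →
       (to (labelling⇔ {f = f}) lab , to (connected⇔shortGaps {f = f}) conn) , ltd)
    (λ ((lab , gaps) , ltd) →
       from (labelling⇔ {f = f}) lab , from (connected⇔shortGaps {f = f}) gaps , ltd)

  count-SDivisionℕ : ∀ {N K c} → S N (+ K) c → Count (SDivisionℕ {N} K) c
  count-SDivisionℕ = count-cong SDivision⇔SDivisionℕ

  module _ {M : ℕ} (f : Vec ℕ (suc M)) (x : ℕ) where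

    newPiece : ∀ {K} → (SDivisionℕ (suc K) (f ∷ʳ x) × ¬ Occurs f x) ⇔ (Division K f × x ≡ K)
    newPiece {K} = mk⇔ removeLast appendLast
      where
      removeLast : SDivisionℕ (suc K) (f ∷ʳ x) × ¬ Occurs f x → Division K f × x ≡ K
      removeLast (((lab , gaps) , _) , x∉f) with 1+K≡1+x , lab′ ← labelling-∷ʳ⁻-new f x lab x∉f
        with refl ← suc-injective (sym 1+K≡1+x) = (lab′ , shortGaps-∷ʳ⁻ f x gaps) , refl
      appendLast : Division K f × x ≡ K → SDivisionℕ (suc K) (f ∷ʳ x) × ¬ Occurs f x
      appendLast ((lab , gaps) , refl) =
        ((labelling-∷ʳ⁺-new f x lab , shortGaps-∷ʳ⁺ f x gaps (inj₁ x∉f)) ,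
         from (lastTwoDiffer-∷ʳ f x) (λ fM≡x → x∉f (fromℕ M , fM≡x))) ,
        x∉f
        where
        x∉f : ¬ Occurs f x
        x∉f = labelling⇒¬occurs f lab

    oldPiece : ∀ {K} → (SDivisionℕ K (f ∷ʳ x) × Occurs f x) ⇔ (SDivisionℕ K f × Penultimate f x)
    oldPiece {K} = mk⇔ removeLast appendLast
      where
      removeLast : SDivisionℕ K (f ∷ʳ x) × Occurs f x → SDivisionℕ K f × Penultimate f x
      removeLast (((lab , gaps) , ltd) , x∈f) =
        ((labelling-∷ʳ⁻-old f x lab x∈f , shortGaps-∷ʳ⁻ f x gaps) , penultimate⇒lastTwoDiffer f pen) ,
        pen
        where
        pen : Penultimate f x
        pen = shortGaps-∷ʳ⇒inLastTwo f x gaps x∈f , to (lastTwoDiffer-∷ʳ f x) ltd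
      appendLast : SDivisionℕ K f × Penultimate f x → SDivisionℕ K (f ∷ʳ x) × Occurs f x
      appendLast (((lab , gaps) , _) , (inLastTwo@(p , fp≡x , _) , fM≢x)) =
        ((labelling-∷ʳ⁺-old f x lab (p , fp≡x) , shortGaps-∷ʳ⁺ f x gaps (inj₂ inLastTwo)) ,
         from (lastTwoDiffer-∷ʳ f x) fM≢x) ,
        (p , fp≡x)

  LastOccurs : ∀ {N} → Vec ℕ (suc N) → Set
  LastOccurs g = Occurs (init g) (last g)

  lastOccurs? : ∀ {N} → Decidable (LastOccurs {N})
  lastOccurs? g = any? (λ i → lookup (init g) i ≟ last g)

  lastOccurs-∷ʳ : ∀ {N} (f : Vec ℕ N) x → LastOccurs (f ∷ʳ x) ⇔ Occurs f x
  lastOccurs-∷ʳ f x =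
    subst₂ (λ f′ x′ → Occurs f′ x′ ⇔ Occurs f x) (sym (init-∷ʳ x f)) (sym (last-∷ʳ x f)) ⇔.refl

  duplicateLast : ∀ {M} → Vec ℕ (suc M) → Vec ℕ (2 + M)
  duplicateLast {M} f = f ∷ʳ lookup f (fromℕ M)

  division-duplicateLast : ∀ {M K} (f : Vec ℕ (suc M)) → Division K (duplicateLast f) ⇔ Division K f
  division-duplicateLast {M} f = mk⇔
    (λ (lab , gaps) → labelling-∷ʳ⁻-old f _ lab last∈f , shortGaps-∷ʳ⁻ f _ gaps)
    (λ (lab , gaps) →
       labelling-∷ʳ⁺-old f _ lab last∈f , shortGaps-∷ʳ⁺ f _ gaps (inj₂ lastInLastTwo))
    where
    last∈f : Occurs f (lookup f (fromℕ M))
    last∈f = fromℕ M , refl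
    lastInLastTwo : InLastTwo f (lookup f (fromℕ M))
    lastInLastTwo = fromℕ M , refl , subst (λ t → suc M ≤ 2 + t) (sym (toℕ-fromℕ M)) (n≤1+n (suc M))

  s-recurrence : ∀ {M K a} → Count (SDivisionℕ {2 + M} (suc K)) a →
    ∃₂ λ v s → Count (Division {suc M} K) v × Count (SDivisionℕ {suc M} (suc K)) s × v + s ≡ a
  s-recurrence {M} {K} count
    with s , v , countOld , countNew , s+v≡a ← count-split lastOccurs? count =
    v , s ,
    count-init (λ _ x → x ≡ K) (λ x≡K y≡K → trans x≡K (sym y≡K)) (λ _ → K , refl)
      (λ f x → ⇔.trans (⇔.refl ×-⇔ ¬-cong-⇔ (lastOccurs-∷ʳ f x)) (newPiece f x)) countNew ,
    count-init Penultimate (λ {f} → penultimate-unique f)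
      (λ {f} (_ , ltd) → lastTwoDiffer⇒penultimate f ltd)
      (λ f x → ⇔.trans (⇔.refl ×-⇔ lastOccurs-∷ʳ f x) (oldPiece f x)) countOld ,
    trans (+-comm v s) s+v≡a

  v-recurrence : ∀ {M K v s} → Count (Division {suc M} K) v → Count (SDivisionℕ {2 + M} K) s →
    Count (Division {2 + M} K) (s + v)
  v-recurrence {M} {K} countV countS =
    count-⊎ disjoint split countS
      (count-image duplicateLast (λ _ _ → ∷ʳ-injectiveˡ _ _) (λ _ → ⇔.refl) countV)
    where
    Duplicated : Vec ℕ (2 + M) → Set
    Duplicated g = ∃[ f ] Division K f × duplicateLast f ≡ g

    disjoint : ∀ g → SDivisionℕ K g → ¬ Duplicated g
    disjoint g (_ , ltd) (f , _ , refl) = to (lastTwoDiffer-∷ʳ f _) ltd refl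

    classify : ∀ g → Division K g → SDivisionℕ K g ⊎ Duplicated g
    classify g div with initLast g
    ... | f , x , refl with lookup f (fromℕ M) ≟ x
    ...   | no fM≢x  = inj₁ (div , from (lastTwoDiffer-∷ʳ f x) fM≢x)
    ...   | yes refl = inj₂ (f , to (division-duplicateLast f) div , refl)

    split : ∀ g → Division K g ⇔ (SDivisionℕ K g ⊎ Duplicated g)
    split g = mk⇔ (classify g)
      Sum.[ proj₁ , (λ { (f , div , refl) → from (division-duplicateLast f) div }) ]′

  s-nonpositive : ∀ {N k c} → k ℤ.≤ ℤ.0ℤ → S (suc N) k c → c ≡ 0
  s-nonpositive k≤0 = count-empty λ _ ((bound , _) , _) → ℤ.+≮0 (ℤ.<-≤-trans (bound zero) k≤0)

open import Data.Nat using (ℕ; _≤_; _∸_; suc; z≤n; s≤s)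
import Data.Nat as ℕ
open import Data.Integer as ℤ using (ℤ; +_; -[1+_]; _+_; _-_; _*_; 1ℤ; 0ℤ)
import Data.Integer.Properties as ℤ
open import Data.Integer.Tactic.RingSolver using (solve-∀)
open import Data.Product using (_,_)
open import Relation.Binary.PropositionalEquality using (_≡_; refl; sym; trans; cong; cong₂)

open Counting using (count-unique)
open HoneycombStrip using (count-SDivisionℕ; s-recurrence; v-recurrence; s-nonpositive)

recurrence-arithmetic : ∀ b v c d → c ≡ v ℕ.+ d → + (b ℕ.+ v ℕ.+ c) ≡ + b + + 2 * + c - + d
recurrence-arithmetic b v c d refl
  rewrite ℤ.pos-+ (b ℕ.+ v) (v ℕ.+ d) | ℤ.pos-+ b v | ℤ.pos-+ v d = ring (+ b) (+ v) (+ d)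
  where
  ring : ∀ (b v d : ℤ) → b + v + (v + d) ≡ b + + 2 * (v + d) - d
  ring = solve-∀

recurrence-nonpositive : ∀ {n k a b c d} → k ℤ.≤ 0ℤ →
  S (3 ℕ.+ n) k a → S (2 ℕ.+ n) (k - 1ℤ) b → S (2 ℕ.+ n) k c → S (1 ℕ.+ n) k d →
  + a ≡ + b + + 2 * + c - + d
recurrence-nonpositive k≤0 Sa Sb Sc Sd
  rewrite s-nonpositive k≤0 Sa | s-nonpositive (ℤ.i≤j⇒i-k≤j 1ℤ k≤0) Sb
        | s-nonpositive k≤0 Sc | s-nonpositive k≤0 Sd = refl

theorem6 : (n : ℕ) → 2 ≤ n → (k : ℤ) → (a b c d : ℕ) →
    S (suc n) k a → S n (k - 1ℤ) b → S n k c → S (n ∸ 1) k d →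
    + a ≡ + b + + 2 * + c - + d
theorem6 (suc (suc n)) (s≤s (s≤s z≤n)) (+ suc K) a b c d Sa Sb Sc Sd
  with v₁ , s₁ , countV₁ , countS₁ , v₁+s₁≡a ← s-recurrence (count-SDivisionℕ Sa)
     | v₀ , s₀ , countV₀ , countS₀ , v₀+s₀≡c ← s-recurrence (count-SDivisionℕ Sc) =
  trans (cong +_ a≡b+v₀+c) (recurrence-arithmetic b v₀ c d c≡v₀+d)
  where
  a≡b+v₀+c : a ≡ b ℕ.+ v₀ ℕ.+ c
  a≡b+v₀+c = trans (sym v₁+s₁≡a)
    (cong₂ ℕ._+_ (count-unique countV₁ (v-recurrence countV₀ (count-SDivisionℕ Sb)))
                 (count-unique countS₁ (count-SDivisionℕ Sc)))
  c≡v₀+d : c ≡ v₀ ℕ.+ d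
  c≡v₀+d = trans (sym v₀+s₀≡c) (cong (v₀ ℕ.+_) (count-unique countS₀ (count-SDivisionℕ Sd)))
theorem6 (suc (suc n)) (s≤s (s≤s z≤n)) (+ 0)    = λ _ _ _ _ → recurrence-nonpositive ℤ.≤-refl
theorem6 (suc (suc n)) (s≤s (s≤s z≤n)) -[1+ _ ] = λ _ _ _ _ → recurrence-nonpositive ℤ.-≤+
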